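{- Let the sequence $(c_k)_{k\ge 0}$ be defined by $c_0=1$ and $c_{k+1}=c_k(c_k-1)/2+2$ for $k\ge 0$. For every (unlabeled, unordered) binary rooted tree $t$ of height $h$, we have \[c_h\le f(t)<c_{h+1},\] where $f$ denotes the Colijn--Plazzotta rank.
   Context: All trees are finite rooted binary trees in which every internal node has exactly two children. The height of a tree is the number of edges on a longest path from the root to a leaf. The Colijn--Plazzotta rank $f(t)$ of an unlabeled unordered binary rooted tree $t$ is defined recursively: if $t$ is a single leaf, $f(t)=1$; otherwise, let $\ell(t)$ and $r(t)$ be the two subtrees of the root, named so that $f(\ell(t))\ge f(r(t))$, and set \[f(t)=\frac{f(\ell(t))\,\big(f(\ell(t))-1\big)}{2}+1+f(r(t)).\] -}

module Defs where

open import Data.Nat using (ℕ; zero; suc; _+_; _*_; _∸_; _⊔_; _⊓_)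
open import Data.Nat.DivMod using (_/_)

-- Unordered trees are represented by (ordered) representatives; all functions
-- below are invariant under swapping children.
data BTree : Set where
  leaf : BTree
  node : BTree → BTree → BTree

height : BTree → ℕ
height leaf = 0
height (node l r) = suc (height l ⊔ height r)

-- triangular helper: n(n-1)/2 (exact, since n(n-1) is even)
half-pred-prod : ℕ → ℕ
half-pred-prod n = (n * (n ∸ 1)) / 2

-- Colijn--Plazzotta rank: the larger-ranked subtree plays the role of ℓ(t)
cpRank : BTree → ℕ
cpRank leaf = 1
cpRank (node a b) =
  half-pred-prod (cpRank a ⊔ cpRank b) + 1 + (cpRank a ⊓ cpRank b)

c : ℕ → ℕ
c zero = 1
c (suc k) = half-pred-prod (c k) + 2

{-# OPTIONS --safe #-}
-- Write T n = n(n-1)/2, so that c_{k+1} = T(c_k) + 2 and a tree with child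
-- ranks M ≥ m has rank T(M) + 1 + m. By induction, if the tree has height
-- h + 1 then c_h ≤ M < c_{h+1} (c is increasing and h is the larger child
-- height) and 1 ≤ m ≤ M. Monotonicity of T gives the lower bound
-- T(c_h) + 1 + 1, and T(n + 1) = T(n) + n gives the upper bound
-- T(M) + 1 + m ≤ T(M + 1) + 1 ≤ T(c_{h+1}) + 1 < c_{h+2}.
module Submission where

open import Data.Nat
  using (zero; suc; _+_; _*_; _∸_; _⊔_; _⊓_; _≤_; _<_; _≤′_; ≤′-refl; ≤′-step; z≤n; s≤s)
open import Data.Nat.Properties
open import Data.Nat.DivMod using (_/_; /-monoˡ-≤; +-distrib-/-∣ʳ; m*n/n≡m)
open import Data.Nat.Divisibility using (divides-refl)
open import Data.Nat.Tactic.RingSolver using (solve-∀)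
open import Data.Product using (_×_; _,_)
open import Relation.Binary.PropositionalEquality using (_≡_; refl; sym; trans; cong; module ≡-Reasoning)

open import Defs

half-pred-prod-mono-≤ : ∀ {m n} → m ≤ n → half-pred-prod m ≤ half-pred-prod n
half-pred-prod-mono-≤ m≤n = /-monoˡ-≤ 2 (*-mono-≤ m≤n (∸-monoˡ-≤ 1 m≤n))

[1+n]*n≡n*[n∸1]+n*2 : ∀ n → suc n * n ≡ n * (n ∸ 1) + n * 2
[1+n]*n≡n*[n∸1]+n*2 zero    = refl
[1+n]*n≡n*[n∸1]+n*2 (suc n) = identity n
  where
  identity : ∀ n → suc (suc n) * suc n ≡ suc n * n + suc n * 2
  identity = solve-∀

half-pred-prod-suc : ∀ n → half-pred-prod (suc n) ≡ half-pred-prod n + n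
half-pred-prod-suc n = begin
  suc n * n / 2                  ≡⟨ cong (_/ 2) ([1+n]*n≡n*[n∸1]+n*2 n) ⟩
  (n * (n ∸ 1) + n * 2) / 2      ≡⟨ +-distrib-/-∣ʳ (n * (n ∸ 1)) (divides-refl n) ⟩
  half-pred-prod n + n * 2 / 2   ≡⟨ cong (half-pred-prod n +_) (m*n/n≡m n 2) ⟩
  half-pred-prod n + n           ∎
  where open ≡-Reasoning

n<half-pred-prod[n]+2 : ∀ n → n < half-pred-prod n + 2
n<half-pred-prod[n]+2 zero    = s≤s z≤n
n<half-pred-prod[n]+2 (suc n) = begin-strict
  suc n                          <⟨ ≤-reflexive (+-comm 2 n) ⟩
  n + 2                          ≤⟨ +-monoˡ-≤ 2 (m≤n+m n (half-pred-prod n)) ⟩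
  half-pred-prod n + n + 2       ≡⟨ cong (_+ 2) (sym (half-pred-prod-suc n)) ⟩
  half-pred-prod (suc n) + 2     ∎
  where open ≤-Reasoning

c[k]<c[1+k] : ∀ k → c k < c (suc k)
c[k]<c[1+k] k = n<half-pred-prod[n]+2 (c k)

c-mono-≤ : ∀ {k l} → k ≤ l → c k ≤ c l
c-mono-≤ k≤l = go (≤⇒≤′ k≤l)
  where
  go : ∀ {k l} → k ≤′ l → c k ≤ c l
  go ≤′-refl                     = ≤-refl
  go {l = suc l} (≤′-step k≤′l) = ≤-trans (go k≤′l) (<⇒≤ (c[k]<c[1+k] l))

c-positive : ∀ k → 1 ≤ c k
c-positive k = c-mono-≤ {0} {k} z≤n

cpRank-step-bounds : ∀ {h M m} → c h ≤ M → M < c (suc h) → 1 ≤ m → m ≤ M →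
  c (suc h) ≤ half-pred-prod M + 1 + m × half-pred-prod M + 1 + m < c (suc (suc h))
cpRank-step-bounds {h} {M} {m} c[h]≤M M<c[1+h] 1≤m m≤M = lower , upper
  where
  open ≤-Reasoning
  lower : c (suc h) ≤ half-pred-prod M + 1 + m
  lower = begin
    half-pred-prod (c h) + 2       ≡⟨ sym (+-assoc (half-pred-prod (c h)) 1 1) ⟩
    half-pred-prod (c h) + 1 + 1   ≤⟨ +-mono-≤ (+-monoˡ-≤ 1 (half-pred-prod-mono-≤ c[h]≤M)) 1≤m ⟩
    half-pred-prod M + 1 + m       ∎
  upper : half-pred-prod M + 1 + m < c (suc (suc h))
  upper = begin-strict
    half-pred-prod M + 1 + m         ≤⟨ +-monoʳ-≤ (half-pred-prod M + 1) m≤M ⟩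
    half-pred-prod M + 1 + M         ≡⟨ trans (+-assoc (half-pred-prod M) 1 M) (+-suc (half-pred-prod M) M) ⟩
    suc (half-pred-prod M + M)       ≡⟨ cong suc (sym (half-pred-prod-suc M)) ⟩
    suc (half-pred-prod (suc M))     ≤⟨ s≤s (half-pred-prod-mono-≤ M<c[1+h]) ⟩
    suc (half-pred-prod (c (suc h))) <⟨ ≤-reflexive (+-comm 2 _) ⟩
    half-pred-prod (c (suc h)) + 2   ∎

lemma1 : (t : BTree) → (c (height t) ≤ cpRank t) × (cpRank t < c (suc (height t)))
lemma1 leaf = s≤s z≤n , s≤s (s≤s z≤n)
lemma1 (node a b) with lemma1 a | lemma1 b
... | c[ha]≤fa , fa<c[1+ha] | c[hb]≤fb , fb<c[1+hb] =
  cpRank-step-bounds {ha ⊔ hb} c[h]≤M M<c[1+h] 1≤m (m⊓n≤m⊔n (cpRank a) (cpRank b))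
  where
  ha = height a
  hb = height b
  c[h]≤M : c (ha ⊔ hb) ≤ cpRank a ⊔ cpRank b
  c[h]≤M = ≤-trans (≤-reflexive (mono-≤-distrib-⊔ c-mono-≤ ha hb))
                   (⊔-mono-≤ c[ha]≤fa c[hb]≤fb)
  M<c[1+h] : cpRank a ⊔ cpRank b < c (suc (ha ⊔ hb))
  M<c[1+h] = ≤-trans (⊔-mono-< fa<c[1+ha] fb<c[1+hb])
                     (≤-reflexive (sym (mono-≤-distrib-⊔ c-mono-≤ (suc ha) (suc hb))))
  1≤m : 1 ≤ cpRank a ⊓ cpRank b
  1≤m = ⊓-glb (≤-trans (c-positive ha) c[ha]≤fa) (≤-trans (c-positive hb) c[hb]≤fb)
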